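{- Let $\mathcal R$ be a TRS and $\mathcal G(\mathcal R)$ a simulating graph rewrite system. There is $\Delta\in\mathbb N$ depending only on $\mathcal G(\mathcal R)$ such that for all term graphs $S,T$ and $\ell\in\mathbb N$: if $S\Rrightarrow^{\ell}_{\mathcal G(\mathcal R)}T$ (an $\ell$-step sequence), then $|T|\le(\ell+1)|S|+\ell^2\Delta$.
   Context: A TRS is a finite set of term rewrite rules. Term graphs: finite acyclic rooted graphs with labels in $\mathcal F\cup\mathcal V$, ordered successor lists (a $k$-ary symbol has $k$ successors, variable nodes none, equal variable labels imply equal nodes). $|S|$ is the number of nodes. Positions: $\mathrm{Pos}_S(u)$ is the set of successor-index sequences of root-to-$u$ paths; $u$ corresponds to $p$ if $p\in\mathrm{Pos}_S(u)$; strictly below $p$: corresponds to some $q$ with $p$ a proper prefix of $q$; $\le$ is the prefix order; $\mathrm{Tree}(s)$: term graphs representing the term $s$ in which every non-variable node has a single position. Morphism $m\colon L\to T$: root-preserving node map with $\mathrm{lab}_T(m(u))=\mathrm{lab}_L(u)$ and $\mathrm{succ}_T(m(u))=m^*(\mathrm{succ}_L(u))$ for non-variable $u$; $S\geq_m T$ if these hold for all nodes. Collapse: fix a strict total order $\succ$ on nodes; for $u\succ v$ in $S$, $S\rhd_{u\mapsto v}T$ if $T$ is a term graph and $S\geq_m T$ for $m(u)=v$, $m(w)=w$ otherwise. $S\downarrow_p T$ if $S\rhd_{u\mapsto v}T$ with $u,v$ strictly below $p$; $S\uparrow_p T$ if $T\rhd_{u\mapsto v}S$ for a node $u$ of $T$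 with $\mathrm{Pos}_T(u)=\{q\}$, $q\le p$. Simulating GRS $\mathcal G(\mathcal R)$: for each rule $l\to r$ a graph rule $L\to R$ ($L\in\mathrm{Tree}(l)$, $R\in\mathrm{Tree}(r)$, common nodes exactly the variable nodes of $R$). $S\Rightarrow_{\mathcal G,p}T$: with $u$ the node at $p$, there is a rule copy $L'\to R'$ node-disjoint from $S$ and a morphism $m\colon L'\to S|_u$ with $T=S[m(R')]_u$ ($m(R')$: replace nodes $v$ in the domain of $m$ by $m(v)$; $S[H]_u$: redirect edges into $u$ to the root of $H$, add $H$, keep nodes reachable from the root of $H$ if $u$ is the root of $S$, else from the root of $S$). $S\Rrightarrow_{\mathcal G(\mathcal R)}T$ means for some position $p$: $S(\uparrow_p)^!\cdot(\downarrow_p)^!\cdot\Rightarrow_{\mathcal G(\mathcal R),p}T$, where $S\to^!T$ means $S\to^*T$ and $T$ is $\to$-minimal. -}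

module Defs where

open import Data.Nat using (ℕ; zero; suc; _+_; _*_; _≤_; _≡ᵇ_)
open import Data.Bool using (Bool; true; false; if_then_else_)
open import Data.List using (List; []; _∷_; _++_; map; length; filter)
open import Data.List.Membership.Propositional using (_∈_; _∉_)
open import Data.List.Membership.DecPropositional Data.Nat._≟_ using (_∈?_)
open import Data.List.Relation.Unary.All using (All)
open import Data.List.Relation.Unary.Unique.Propositional using (Unique)
open import Data.List.Relation.Binary.Pointwise using (Pointwise)
open import Data.Vec using (Vec; toList)
import Data.Vec.Relation.Unary.Any as VAny
open import Data.Sum using (_⊎_; inj₁; inj₂)
open import Data.Product using (Σ; _×_; _,_; ∃; ∃-syntax)
open import Relation.Nullary using (¬_; ¬?; does)
open import Relation.Binary.PropositionalEquality using (_≡_)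
open import Relation.Binary.Core using (Rel)
open import Relation.Binary.Construct.Closure.ReflexiveTransitive using (Star)
open import Relation.Binary.Construct.Closure.Transitive using (TransClosure)
open import Level using (0ℓ)

record Signature : Set₁ where
  field
    Fun   : Set
    Var   : Set
    arity : Fun → ℕ

data Iter {A : Set} (R : A → A → Set) : ℕ → A → A → Set where
  zero : ∀ {a} → Iter R zero a a
  step : ∀ {n a b c} → R a b → Iter R n b c → Iter R (suc n) a c

NF : {A : Set} → (A → A → Set) → A → Set
NF R a = ∀ b → ¬ R a b

Bang : {A : Set} → (A → A → Set) → A → A → Set
Bang R a b = Star R a b × NF R b

data Nth {A : Set} : List A → ℕ → A → Set where
  here  : ∀ {x xs} → Nth (x ∷ xs) zero x
  there : ∀ {x y xs i} → Nth xs i y → Nth (x ∷ xs) (suc i) y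

-- Positions are lists of (0-based) successor indices.
Position : Set
Position = List ℕ

_≤ₚ_ : Position → Position → Set
q ≤ₚ p = ∃[ r ] (p ≡ q ++ r)

_<ₚ_ : Position → Position → Set
p <ₚ q = ∃[ i ] ∃[ r ] (q ≡ p ++ (i ∷ r))

module TRS (Sig : Signature) where
  open Signature Sig

  data Term : Set where
    var : Var → Term
    app : (f : Fun) → Vec Term (arity f) → Term

  data Occurs (x : Var) : Term → Set where
    here  : Occurs x (var x)
    under : ∀ {f ts} → VAny.Any (Occurs x) ts → Occurs x (app f ts)

  Rule : Set
  Rule = Term × Term

  IsRule : Rule → Set
  IsRule (l , r) = (∀ x → ¬ (l ≡ var x)) × (∀ x → Occurs x r → Occurs x l)

  IsTRS : List Rule → Set
  IsTRS rs = All IsRule rs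

  Label : Set
  Label = Fun ⊎ Var

  arityL : Label → ℕ
  arityL (inj₁ f) = arity f
  arityL (inj₂ x) = 0

  -- Raw graphs: nodes are natural numbers (global node universe);
  -- lab and succ are only meaningful on the listed nodes.
  record Graph : Set where
    constructor mkGraph
    field
      nodes : List ℕ
      root  : ℕ
      lab   : ℕ → Label
      succ  : ℕ → List ℕ
  open Graph public

  Edge : Graph → ℕ → ℕ → Set
  Edge G u v = (u ∈ nodes G) × (v ∈ succ G u)

  Reach : Graph → ℕ → ℕ → Set
  Reach G = Star (Edge G)

  Reach⁺ : Graph → ℕ → ℕ → Set
  Reach⁺ G = TransClosure (Edge G)

  record IsTermGraph (G : Graph) : Set where
    field
      unique   : Unique (nodes G)
      root∈    : root G ∈ nodes G
      arity-ok : ∀ u → u ∈ nodes G → length (succ G u) ≡ arityL (lab G u)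
      succ-ok  : ∀ u → u ∈ nodes G → All (_∈ nodes G) (succ G u)
      var-inj  : ∀ u v x → u ∈ nodes G → v ∈ nodes G →
                 lab G u ≡ inj₂ x → lab G v ≡ inj₂ x → u ≡ v
      acyclic  : ∀ u → ¬ Reach⁺ G u u
      rooted   : ∀ u → u ∈ nodes G → Reach G (root G) u

  size : Graph → ℕ
  size G = length (nodes G)

  data PathTo (G : Graph) : ℕ → Position → ℕ → Set where
    here : ∀ {u} → PathTo G u [] u
    step : ∀ {u i w p v} → u ∈ nodes G → Nth (succ G u) i w →
           PathTo G w p v → PathTo G u (i ∷ p) v

  Pos : Graph → Position → ℕ → Set
  Pos G p v = PathTo G (root G) p v

  StrictlyBelow : Graph → Position → ℕ → Set
  StrictlyBelow G p v = ∃[ q ] (Pos G q v × p <ₚ q)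

  data Unfold (G : Graph) : ℕ → Term → Set where
    var : ∀ {u x} → lab G u ≡ inj₂ x → Unfold G u (var x)
    app : ∀ {u f ts} → lab G u ≡ inj₁ f →
          Pointwise (Unfold G) (succ G u) (toList ts) → Unfold G u (app f ts)

  InTree : Graph → Term → Set
  InTree G s = IsTermGraph G × Unfold G (root G) s ×
               (∀ u p q → u ∈ nodes G → (∀ x → ¬ (lab G u ≡ inj₂ x)) →
                 Pos G p u → Pos G q u → p ≡ q)

  record Morphism (m : ℕ → ℕ) (L T : Graph) : Set where
    field
      root-pres : m (root L) ≡ root T
      into      : ∀ u → u ∈ nodes L → m u ∈ nodes T
      lab-pres  : ∀ u f → u ∈ nodes L → lab L u ≡ inj₁ f → lab T (m u) ≡ lab L u
      succ-pres : ∀ u f → u ∈ nodes L → lab L u ≡ inj₁ f →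
                  succ T (m u) ≡ map m (succ L u)

  record Geq (m : ℕ → ℕ) (S T : Graph) : Set where
    field
      root-pres : m (root S) ≡ root T
      into      : ∀ u → u ∈ nodes S → m u ∈ nodes T
      lab-pres  : ∀ u → u ∈ nodes S → lab T (m u) ≡ lab S u
      succ-pres : ∀ u → u ∈ nodes S → succ T (m u) ≡ map m (succ S u)

  upd : ℕ → ℕ → ℕ → ℕ
  upd u v w = if w ≡ᵇ u then v else w

  record RestrictAt (G : Graph) (r : ℕ) (T : Graph) : Set where
    field
      nodes-iff₁ : ∀ w → w ∈ nodes T → w ∈ nodes G × Reach G r w
      nodes-iff₂ : ∀ w → w ∈ nodes G → Reach G r w → w ∈ nodes T
      root-eq    : root T ≡ r
      lab-eq     : ∀ w → w ∈ nodes T → lab T w ≡ lab G w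
      succ-eq    : ∀ w → w ∈ nodes T → succ T w ≡ succ G w

  GraphRule : Set
  GraphRule = Graph × Graph

  Simulates : Rule → GraphRule → Set
  Simulates (l , r) (L , R) =
    InTree L l × InTree R r ×
    (∀ u → (u ∈ nodes L × u ∈ nodes R) → (u ∈ nodes R × ∃[ x ] (lab R u ≡ inj₂ x))) ×
    (∀ u x → u ∈ nodes R → lab R u ≡ inj₂ x → u ∈ nodes L) ×
    (∀ u → u ∈ nodes L → u ∈ nodes R → lab L u ≡ lab R u)

  IsSimulatingGRS : List Rule → List GraphRule → Set
  IsSimulatingGRS rs gs = Pointwise Simulates rs gs

  record Renaming (φ : ℕ → ℕ) (G G' : Graph) : Set where
    field
      nodes-iff₁ : ∀ w → w ∈ nodes G' → ∃[ u ] (u ∈ nodes G × w ≡ φ u)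
      nodes-iff₂ : ∀ u → u ∈ nodes G → φ u ∈ nodes G'
      root-eq    : root G' ≡ φ (root G)
      lab-eq     : ∀ u → u ∈ nodes G → lab G' (φ u) ≡ lab G u
      succ-eq    : ∀ u → u ∈ nodes G → succ G' (φ u) ≡ map φ (succ G u)

  IsCopy : GraphRule → GraphRule → Set
  IsCopy (L , R) (L' , R') = ∃[ φ ]
    ((∀ u v → u ∈ nodes L ++ nodes R → v ∈ nodes L ++ nodes R → φ u ≡ φ v → u ≡ v) ×
     Renaming φ L L' × Renaming φ R R')

  -- The graph S with m(R') added and edges into u redirected to the root
  -- of m(R') (before garbage removal)
  combine : Graph → ℕ → (ℕ → ℕ) → Graph → Graph → Graph
  combine S u m L' R' = mkGraph ns rt lb sc
    where
    inL : ℕ → Bool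
    inL w = does (w ∈? nodes L')
    inS : ℕ → Bool
    inS w = does (w ∈? nodes S)
    ρ : ℕ → ℕ
    ρ w = if inL w then m w else w
    h : ℕ
    h = ρ (root R')
    redirect : ℕ → ℕ
    redirect w = if w ≡ᵇ u then h else w
    ns : List ℕ
    ns = nodes S ++ filter (λ w → ¬? (w ∈? nodes L')) (nodes R')
    rt : ℕ
    rt = if root S ≡ᵇ u then h else root S
    lb : ℕ → Label
    lb w = if inS w then lab S w else lab R' w
    sc : ℕ → List ℕ
    sc w = if inS w then map redirect (succ S w) else map ρ (succ R' w)

  Replace : Graph → ℕ → (ℕ → ℕ) → Graph → Graph → Graph → Set
  Replace S u m L' R' T = RestrictAt G (root G) T
    where G = combine S u m L' R'

  RewriteStep : List GraphRule → Position → Graph → Graph → Set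
  RewriteStep gs p S T =
    IsTermGraph S × IsTermGraph T ×
    ∃[ u ] (Pos S p u ×
      ∃[ ρ ] (ρ ∈ gs ×
        ∃[ L' ] ∃[ R' ] (IsCopy ρ (L' , R') ×
          (∀ w → w ∈ nodes L' ++ nodes R' → w ∉ nodes S) ×
          ∃[ H ] (RestrictAt S u H ×
            ∃[ m ] (Morphism m L' H × Replace S u m L' R' T)))))

  module Collapsing (_≻_ : ℕ → ℕ → Set) where

    Collapse : ℕ → ℕ → Graph → Graph → Set
    Collapse u v S T = IsTermGraph S × IsTermGraph T ×
      u ∈ nodes S × v ∈ nodes S × u ≻ v × Geq (upd u v) S T

    Down : Position → Graph → Graph → Set
    Down p S T = ∃[ u ] ∃[ v ]
      (StrictlyBelow S p u × StrictlyBelow S p v × Collapse u v S T)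

    Up : Position → Graph → Graph → Set
    Up p S T = ∃[ u ] ∃[ v ] (Collapse u v T S × u ∈ nodes T ×
      ∃[ q ] (Pos T q u × (∀ q' → Pos T q' u → q' ≡ q) × q ≤ₚ p))

    Step : List GraphRule → Graph → Graph → Set
    Step gs S T = ∃[ p ] ∃[ S₁ ] ∃[ S₂ ]
      (Bang (Up p) S S₁ × Bang (Down p) S₁ S₂ × RewriteStep gs p S₂ T)

module Submission where

-- Besides the size we track a bound d on the depth (the length of positions)
-- of the current term graph; initially d = |S|.  In a step at position p, every
-- ↑_p step unshares a node whose unique position is a prefix of p, and these
-- positions are pairwise distinct (each was shared before it was unshared), so
-- unsharing adds at most |p| + 1 ≤ d + 1 nodes.  The ↓_p steps add neither nodes
-- nor depth, and the rewrite step adds at most |R| nodes and lengthens positions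
-- by at most |R|.  With Δ = 1 + Σ |R| a step thus adds at most d + Δ nodes and Δ
-- to the depth, and summing over ℓ steps gives (ℓ + 1)|S| + ℓ²Δ.

open import Defs
open import Data.Nat using (ℕ; zero; suc; _+_; _*_; _≤_; _<_; z≤n; s≤s; _≟_; _≡ᵇ_)
open import Data.Nat.Properties
open import Data.Nat.ListAction using (sum)
open import Data.Nat.Tactic.RingSolver using (solve-∀)
open import Data.Bool using (true; false; if_then_else_)
open import Data.List using (List; []; _∷_; _++_; [_]; map; length; upTo)
open import Data.List.Properties using (length-++; length-map; length-upTo; ++-assoc; ++-identityʳ; ∷-injective)
open import Data.List.Membership.Propositional using (_∈_; _∉_)
open import Data.List.Membership.Propositional.Properties
  using (∈-∃++; ∈-++⁻; ∈-++⁺ˡ; ∈-++⁺ʳ; ∈-map⁻; ∈-map⁺; ∈-upTo⁺; ∈-filter⁻)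
open import Data.List.Membership.DecPropositional _≟_ using (_∈?_)
open import Data.List.Relation.Unary.All as All using (All; []; _∷_)
open import Data.List.Relation.Unary.All.Properties using (map⁺)
open import Data.List.Relation.Unary.Any using (here; there)
open import Data.List.Relation.Unary.AllPairs using ([]; _∷_)
open import Data.List.Relation.Unary.Unique.Propositional using (Unique)
open import Data.List.Relation.Binary.Pointwise using (_∷_)
open import Data.Product using (_×_; _,_; ∃-syntax; proj₁; proj₂)
open import Data.Sum using (inj₁; inj₂)
open import Data.Empty using (⊥-elim)
open import Function using (_∘′_)
open import Relation.Nullary using (¬_; Dec; yes; no; does)
open import Relation.Nullary.Decidable using (dec-true; dec-false)
open import Relation.Binary.PropositionalEquality hiding ([_])
open import Relation.Binary.Structures using (IsStrictTotalOrder)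
open import Relation.Binary.Construct.Closure.ReflexiveTransitive using (Star; ε; _◅_; _◅◅_)
open import Relation.Binary.Construct.Closure.Transitive using () renaming ([_] to [_]⁺; _∷_ to _∷⁺_)

Unique-⊆⇒length≤ : ∀ {A : Set} {xs ys : List A} →
  Unique xs → (∀ {z} → z ∈ xs → z ∈ ys) → length xs ≤ length ys
Unique-⊆⇒length≤ {xs = []} _ _ = z≤n
Unique-⊆⇒length≤ {xs = x ∷ xs} {ys} (x∉xs ∷ xs!) xs⊆ys with ∈-∃++ (xs⊆ys (here refl))
... | as , bs , refl = begin
  suc (length xs)             ≤⟨ s≤s (Unique-⊆⇒length≤ xs! xs⊆as++bs) ⟩
  suc (length (as ++ bs))     ≡⟨ cong suc (length-++ as) ⟩
  suc (length as + length bs) ≡⟨ sym (+-suc (length as) (length bs)) ⟩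
  length as + length (x ∷ bs) ≡⟨ sym (length-++ as) ⟩
  length (as ++ x ∷ bs)       ∎
  where
  open ≤-Reasoning
  xs⊆as++bs : ∀ {z} → z ∈ xs → z ∈ as ++ bs
  xs⊆as++bs z∈xs with ∈-++⁻ as (xs⊆ys (there z∈xs))
  ... | inj₁ z∈as         = ∈-++⁺ˡ z∈as
  ... | inj₂ (here refl)  = ⊥-elim (All.lookup x∉xs z∈xs refl)
  ... | inj₂ (there z∈bs) = ∈-++⁺ʳ as z∈bs

length-++-middle : ∀ {A : Set} (xs ys zs : List A) →
  length (xs ++ ys ++ zs) ≡ length (xs ++ zs) + length ys
length-++-middle xs ys zs = begin
  length (xs ++ ys ++ zs)             ≡⟨ length-++ xs ⟩
  length xs + length (ys ++ zs)       ≡⟨ cong (length xs +_) (length-++ ys) ⟩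
  length xs + (length ys + length zs) ≡⟨ +-comm-middle (length xs) (length ys) (length zs) ⟩
  length xs + length zs + length ys   ≡⟨ cong (_+ length ys) (sym (length-++ xs)) ⟩
  length (xs ++ zs) + length ys       ∎
  where
  open ≡-Reasoning
  +-comm-middle : ∀ a b c → a + (b + c) ≡ a + c + b
  +-comm-middle a b c = trans (cong (a +_) (+-comm b c)) (sym (+-assoc a c b))

++-injective-by-length : ∀ {A : Set} (xs xs' : List A) {ys ys' : List A} →
  xs ++ ys ≡ xs' ++ ys' → length xs ≡ length xs' → xs ≡ xs'
++-injective-by-length []       []        _ _ = refl
++-injective-by-length (x ∷ xs) (x' ∷ xs') e l with ∷-injective e
... | refl , e' = cong (x ∷_) (++-injective-by-length xs xs' e' (suc-injective l))

prefix-length-injective : ∀ {p q q' : Position} →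
  q ≤ₚ p → q' ≤ₚ p → length q ≡ length q' → q ≡ q'
prefix-length-injective {q = q} {q'} (_ , e) (_ , e') = ++-injective-by-length q q' (trans (sym e) e')

-- A prefix is determined by its length, so there are at most |p| + 1 of them.
Unique-prefixes-length≤ : ∀ {p : Position} {Qs : List Position} →
  Unique Qs → All (_≤ₚ p) Qs → length Qs ≤ suc (length p)
Unique-prefixes-length≤ {p = p} {Qs} Qs! Qs≤p =
  subst₂ _≤_ (length-map length Qs) (length-upTo (suc (length p)))
    (Unique-⊆⇒length≤ (lengths-distinct Qs! Qs≤p) lengths-bounded)
  where
  lengths-distinct : ∀ {Qs} → Unique Qs → All (_≤ₚ p) Qs → Unique (map length Qs)
  lengths-distinct [] [] = []
  lengths-distinct (q∉ ∷ Qs!) (q≤p ∷ Qs≤p) =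
    map⁺ (All.zipWith (λ (q≢q' , q'≤p) → q≢q' ∘′ prefix-length-injective q≤p q'≤p) (q∉ , Qs≤p))
    ∷ lengths-distinct Qs! Qs≤p
  lengths-bounded : ∀ {n} → n ∈ map length Qs → n ∈ upTo (suc (length p))
  lengths-bounded n∈ with ∈-map⁻ length n∈
  ... | q , q∈Qs , refl with All.lookup Qs≤p q∈Qs
  ... | r , refl = ∈-upTo⁺ (s≤s (subst (length q ≤_) (sym (length-++ q)) (m≤m+n _ _)))

if-true : ∀ {A : Set} {b} {x y : A} → b ≡ true → (if b then x else y) ≡ x
if-true refl = refl

if-false : ∀ {A : Set} {b} {x y : A} → b ≡ false → (if b then x else y) ≡ y
if-false refl = refl

Nth⇒∈ : ∀ {A : Set} {xs : List A} {i x} → Nth xs i x → x ∈ xs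
Nth⇒∈ here      = here refl
Nth⇒∈ (there n) = there (Nth⇒∈ n)

∈⇒Nth : ∀ {A : Set} {xs : List A} {x} → x ∈ xs → ∃[ i ] Nth xs i x
∈⇒Nth (here refl) = zero , here
∈⇒Nth (there x∈) with ∈⇒Nth x∈
... | i , n = suc i , there n

Nth-map⁺ : ∀ {A B : Set} {f : A → B} {xs i x} → Nth xs i x → Nth (map f xs) i (f x)
Nth-map⁺ here      = here
Nth-map⁺ (there n) = there (Nth-map⁺ n)

Nth-map⁻ : ∀ {A B : Set} {f : A → B} {xs i y} → Nth (map f xs) i y → ∃[ x ] (Nth xs i x × y ≡ f x)
Nth-map⁻ {xs = x ∷ _} here = x , here , refl
Nth-map⁻ {xs = _ ∷ _} (there n) with Nth-map⁻ n
... | x , n' , refl = x , there n' , refl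

Nth-functional : ∀ {A : Set} {xs : List A} {i x y} → Nth xs i x → Nth xs i y → x ≡ y
Nth-functional here      here       = refl
Nth-functional (there n) (there n') = Nth-functional n n'

module _ {Sig : Signature} where
  open TRS Sig

  PathTo-++ : ∀ {G a b c q r} → PathTo G a q b → PathTo G b r c → PathTo G a (q ++ r) c
  PathTo-++ here          π' = π'
  PathTo-++ (step a∈ n π) π' = step a∈ n (PathTo-++ π π')

  PathTo-∷ʳ : ∀ {G a b c q i} → PathTo G a q b → b ∈ nodes G → Nth (succ G b) i c →
    PathTo G a (q ++ [ i ]) c
  PathTo-∷ʳ π b∈ n = PathTo-++ π (step b∈ n here)

  PathTo-functional : ∀ {G a b c q} → PathTo G a q b → PathTo G a q c → b ≡ c
  PathTo-functional here          here            = refl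
  PathTo-functional (step _ n π) (step _ n' π') rewrite Nth-functional n n' = PathTo-functional π π'

  Reach⇒PathTo : ∀ {G a b} → Reach G a b → ∃[ q ] PathTo G a q b
  Reach⇒PathTo ε = [] , here
  Reach⇒PathTo ((a∈ , w∈) ◅ r) with ∈⇒Nth w∈ | Reach⇒PathTo r
  ... | i , n | q , π = i ∷ q , step a∈ n π

  RestrictAt-PathTo : ∀ {G r T a q b} → RestrictAt G r T → PathTo T a q b → PathTo G a q b
  RestrictAt-PathTo T≤G here = here
  RestrictAt-PathTo {q = i ∷ _} T≤G (step a∈ n π) =
    step (proj₁ (RestrictAt.nodes-iff₁ T≤G _ a∈))
         (subst (λ ws → Nth ws i _) (RestrictAt.succ-eq T≤G _ a∈) n)
         (RestrictAt-PathTo T≤G π)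

  child∈ : ∀ {G a i b} → IsTermGraph G → a ∈ nodes G → Nth (succ G a) i b → b ∈ nodes G
  child∈ tg a∈ n = All.lookup (IsTermGraph.succ-ok tg _ a∈) (Nth⇒∈ n)

  no-back-edge : ∀ {G a b} → IsTermGraph G → Reach G a b → ¬ Edge G b a
  no-back-edge {G} tg r e = IsTermGraph.acyclic tg _ (r ◅⁺ e)
    where
    _◅⁺_ : ∀ {a b c} → Reach G a b → Edge G b c → Reach⁺ G a c
    ε        ◅⁺ e = [ e ]⁺
    (e' ◅ r) ◅⁺ e = e' ∷⁺ (r ◅⁺ e)

  -- In an acyclic graph the nodes visited by a path are distinct.
  PathTo-length< : ∀ {G a b q} → IsTermGraph G → a ∈ nodes G → PathTo G a q b → length q < size G
  PathTo-length< {G} tg a∈ π =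
    subst (_≤ size G) (visited-length π) (Unique-⊆⇒length≤ (visited-Unique π) (visited-⊆ a∈ π))
    where
    visited : ∀ {a b q} → PathTo G a q b → List ℕ
    visited {a} here         = a ∷ []
    visited {a} (step _ _ π) = a ∷ visited π

    visited-length : ∀ {a b q} (π : PathTo G a q b) → length (visited π) ≡ suc (length q)
    visited-length here         = refl
    visited-length (step _ _ π) = cong suc (visited-length π)

    visited-reachable : ∀ {a b q z} (π : PathTo G a q b) → z ∈ visited π → Reach G a z
    visited-reachable here          (here refl) = ε
    visited-reachable (step _ _ _)  (here refl) = ε
    visited-reachable (step a∈ n π) (there z∈)  = (a∈ , Nth⇒∈ n) ◅ visited-reachable π z∈

    visited-⊆ : ∀ {a b q z} → a ∈ nodes G → (π : PathTo G a q b) → z ∈ visited π → z ∈ nodes G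
    visited-⊆ a∈ here          (here refl) = a∈
    visited-⊆ a∈ (step _ _ _)  (here refl) = a∈
    visited-⊆ _  (step a∈ n π) (there z∈)  = visited-⊆ (child∈ tg a∈ n) π z∈

    visited-Unique : ∀ {a b q} (π : PathTo G a q b) → Unique (visited π)
    visited-Unique here          = [] ∷ []
    visited-Unique (step a∈ n π) =
      All.tabulate (λ z∈ a≡z → no-back-edge tg (subst (Reach G _) (sym a≡z) (visited-reachable π z∈))
                                              (a∈ , Nth⇒∈ n))
      ∷ visited-Unique π

  Pos-length< : ∀ {G b q} → IsTermGraph G → Pos G q b → length q < size G
  Pos-length< tg = PathTo-length< tg (IsTermGraph.root∈ tg)

  DepthBound : Graph → ℕ → Set
  DepthBound G d = ∀ {q x} → Pos G q x → length q ≤ d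

  DepthBound-mono : ∀ {G d d'} → d ≤ d' → DepthBound G d → DepthBound G d'
  DepthBound-mono d≤d' bound π = ≤-trans (bound π) d≤d'

  size-DepthBound : ∀ {G} → IsTermGraph G → DepthBound G (size G)
  size-DepthBound tg π = <⇒≤ (Pos-length< tg π)

  Geq-PathTo : ∀ {m A B a b q} → IsTermGraph A → Geq m A B → a ∈ nodes A →
    PathTo A a q b → PathTo B (m a) q (m b)
  Geq-PathTo tg A≥B a∈ here = here
  Geq-PathTo {q = i ∷ _} tg A≥B a∈ (step _ n π) =
    step (Geq.into A≥B _ a∈) (subst (λ ws → Nth ws i _) (sym (Geq.succ-pres A≥B _ a∈)) (Nth-map⁺ n))
         (Geq-PathTo tg A≥B (child∈ tg a∈ n) π)

  Geq-Pos : ∀ {m A B b q} → IsTermGraph A → Geq m A B → Pos A q b → Pos B q (m b)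
  Geq-Pos {B = B} tg A≥B π =
    subst (λ r → PathTo B r _ _) (Geq.root-pres A≥B) (Geq-PathTo tg A≥B (IsTermGraph.root∈ tg) π)

  Geq-PathTo⁻ : ∀ {m A B a x c q} → IsTermGraph A → Geq m A B → a ∈ nodes A → x ≡ m a →
    PathTo B x q c → ∃[ b ] PathTo A a q b
  Geq-PathTo⁻ tg A≥B a∈ _ here = _ , here
  Geq-PathTo⁻ {q = i ∷ _} tg A≥B a∈ refl (step _ n π)
    with Nth-map⁻ (subst (λ ws → Nth ws i _) (Geq.succ-pres A≥B _ a∈) n)
  ... | w , n' , x≡mw with Geq-PathTo⁻ tg A≥B (child∈ tg a∈ n') x≡mw π
  ... | b , π' = b , step a∈ n' π'

  Geq-DepthBound : ∀ {m A B d} → IsTermGraph A → Geq m A B → DepthBound A d → DepthBound B d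
  Geq-DepthBound tg A≥B bound π =
    bound (proj₂ (Geq-PathTo⁻ tg A≥B (IsTermGraph.root∈ tg) (sym (Geq.root-pres A≥B)) π))

  Geq-DepthBound⁻ : ∀ {m A B d} → IsTermGraph A → Geq m A B → DepthBound B d → DepthBound A d
  Geq-DepthBound⁻ tg A≥B bound π = bound (Geq-Pos tg A≥B π)

  -- Every node of B is reachable from the root, hence in the image of m.
  Geq-size : ∀ {m A B} → IsTermGraph A → IsTermGraph B → Geq m A B → size B ≤ size A
  Geq-size {m} {A} {B} tgA tgB A≥B =
    subst (size B ≤_) (length-map m (nodes A)) (Unique-⊆⇒length≤ (IsTermGraph.unique tgB) B⊆mA)
    where
    image-closed : ∀ {a b} → Reach B a b → a ∈ map m (nodes A) → b ∈ map m (nodes A)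
    image-closed ε a∈ = a∈
    image-closed ((_ , c∈) ◅ r) a∈ with ∈-map⁻ m a∈
    ... | a' , a'∈ , refl with ∈-map⁻ m (subst (_ ∈_) (Geq.succ-pres A≥B a' a'∈) c∈)
    ... | c' , c'∈ , refl =
      image-closed r (∈-map⁺ m (All.lookup (IsTermGraph.succ-ok tgA a' a'∈) c'∈))
    B⊆mA : ∀ {z} → z ∈ nodes B → z ∈ map m (nodes A)
    B⊆mA z∈ = image-closed (IsTermGraph.rooted tgB _ z∈)
      (subst (_∈ map m (nodes A)) (Geq.root-pres A≥B) (∈-map⁺ m (IsTermGraph.root∈ tgA)))

  upd-≡ : ∀ u v → upd u v u ≡ v
  upd-≡ u v = if-true (dec-true (u ≟ u) refl)

  upd-≢ : ∀ {u v w} → w ≢ u → upd u v w ≡ w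
  upd-≢ {u} {w = w} w≢u = if-false (dec-false (w ≟ u) w≢u)

  upd-size : ∀ {u v A B} → IsTermGraph A → Geq (upd u v) A B → size A ≤ suc (size B)
  upd-size {u} {v} {A} {B} tg A≥B = Unique-⊆⇒length≤ (IsTermGraph.unique tg) A⊆u∷B
    where
    A⊆u∷B : ∀ {z} → z ∈ nodes A → z ∈ u ∷ nodes B
    A⊆u∷B {z} z∈ with z ≟ u
    ... | yes z≡u = here z≡u
    ... | no z≢u  = there (subst (_∈ nodes B) (upd-≢ z≢u) (Geq.into A≥B z z∈))

  module Replacement {S H L' R' R : Graph} {u d : ℕ} {m φ : ℕ → ℕ}
    (tgS : IsTermGraph S) (S-depth : DepthBound S d)
    (H-below-u : RestrictAt S u H) (m-morphism : Morphism m L' H)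
    (tgR : IsTermGraph R) (R'-copy : Renaming φ R R')
    (fresh : ∀ w → w ∈ nodes L' ++ nodes R' → w ∉ nodes S) where

    G : Graph
    G = combine S u m L' R'

    instantiate : ℕ → ℕ
    instantiate w = if does (w ∈? nodes L') then m w else w

    h : ℕ
    h = instantiate (root R')

    redirect : ℕ → ℕ
    redirect w = if w ≡ᵇ u then h else w

    instantiate-∈ : ∀ {w} → w ∈ nodes L' → instantiate w ≡ m w
    instantiate-∈ {w} w∈ = if-true (dec-true (w ∈? nodes L') w∈)

    instantiate-∉ : ∀ {w} → w ∉ nodes L' → instantiate w ≡ w
    instantiate-∉ {w} w∉ = if-false (dec-false (w ∈? nodes L') w∉)

    redirect-≡ : redirect u ≡ h
    redirect-≡ = if-true (dec-true (u ≟ u) refl)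

    redirect-≢ : ∀ {w} → w ≢ u → redirect w ≡ w
    redirect-≢ {w} w≢u = if-false (dec-false (w ≟ u) w≢u)

    succ-old : ∀ {w} → w ∈ nodes S → succ G w ≡ map redirect (succ S w)
    succ-old {w} w∈ = if-true (dec-true (w ∈? nodes S) w∈)

    succ-new : ∀ {a} → a ∈ nodes R → succ G (φ a) ≡ map instantiate (map φ (succ R a))
    succ-new {a} a∈ = begin
      succ G (φ a)                    ≡⟨ if-false (dec-false (φ a ∈? nodes S) φa∉S) ⟩
      map instantiate (succ R' (φ a)) ≡⟨ cong (map instantiate) (Renaming.succ-eq R'-copy a a∈) ⟩
      map instantiate (map φ (succ R a)) ∎
      where
      open ≡-Reasoning
      φa∉S = fresh (φ a) (∈-++⁺ʳ (nodes L') (Renaming.nodes-iff₂ R'-copy a a∈))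

    matched-below-u : ∀ {w} → w ∈ nodes L' → m w ∈ nodes S × Reach S u (m w)
    matched-below-u {w} w∈ = RestrictAt.nodes-iff₁ H-below-u (m w) (Morphism.into m-morphism w w∈)

    -- Acyclicity: no edge below u leads back to u, so nothing there is redirected.
    path-below-u : ∀ {x q w} → x ∈ nodes S → Reach S u x → PathTo G x q w → PathTo S x q w
    path-below-u x∈ u↝x here = here
    path-below-u {q = i ∷ _} x∈ u↝x (step _ n π)
      with Nth-map⁻ (subst (λ ws → Nth ws i _) (succ-old x∈) n)
    ... | z , nz , refl with z ≟ u
    ... | yes refl = ⊥-elim (no-back-edge tgS u↝x (x∈ , Nth⇒∈ nz))
    ... | no z≢u   = step x∈ nz (path-below-u (child∈ tgS x∈ nz) (u↝x ◅◅ ((x∈ , Nth⇒∈ nz) ◅ ε))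
                                 (subst (λ t → PathTo G t _ _) (redirect-≢ z≢u) π))

    below-u-bound : ∀ {qᵤ x q w} → Pos S qᵤ u → x ∈ nodes S → Reach S u x → PathTo G x q w →
      length (qᵤ ++ q) ≤ d
    below-u-bound {qᵤ} {q = q} πᵤ x∈ u↝x π with Reach⇒PathTo u↝x
    ... | r , πᵣ = begin
      length (qᵤ ++ q)            ≤⟨ m≤m+n _ _ ⟩
      length (qᵤ ++ q) + length r ≡⟨ sym (length-++-middle qᵤ r q) ⟩
      length (qᵤ ++ r ++ q)       ≤⟨ S-depth (PathTo-++ πᵤ (PathTo-++ πᵣ (path-below-u x∈ u↝x π))) ⟩
      d                           ∎
      where open ≤-Reasoning

    -- A path through the new nodes stays inside the contractum R until it
    -- enters a matched node, and from there on it runs below u in S.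
    contractum-bound : ∀ {qᵤ a qₐ q w} →
      Pos S qᵤ u → a ∈ nodes R → Pos R qₐ a → φ a ∉ nodes L' → PathTo G (φ a) q w →
      length (qᵤ ++ qₐ ++ q) ≤ d + size R
    contractum-bound {qᵤ} {qₐ = qₐ} πᵤ a∈ πₐ _ here = begin
      length (qᵤ ++ qₐ ++ [])  ≡⟨ cong (length ∘′ (qᵤ ++_)) (++-identityʳ qₐ) ⟩
      length (qᵤ ++ qₐ)        ≡⟨ length-++ qᵤ ⟩
      length qᵤ + length qₐ    ≤⟨ +-mono-≤ (S-depth πᵤ) (<⇒≤ (Pos-length< tgR πₐ)) ⟩
      d + size R               ∎
      where open ≤-Reasoning
    contractum-bound {qᵤ} {a} {qₐ} {i ∷ q} πᵤ a∈ πₐ _ (step _ n π)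
      with Nth-map⁻ (subst (λ ws → Nth ws i _) (succ-new a∈) n)
    ... | _ , nφ , refl with Nth-map⁻ nφ
    ... | b , nb , refl with φ b ∈? nodes L'
    ... | yes φb∈L' = begin
      length (qᵤ ++ qₐ ++ i ∷ q)              ≡⟨ cong (length ∘′ (qᵤ ++_)) (sym (++-assoc qₐ [ i ] q)) ⟩
      length (qᵤ ++ (qₐ ++ [ i ]) ++ q)       ≡⟨ length-++-middle qᵤ (qₐ ++ [ i ]) q ⟩
      length (qᵤ ++ q) + length (qₐ ++ [ i ]) ≤⟨ +-mono-≤ below-u (<⇒≤ (Pos-length< tgR πb)) ⟩
      d + size R                              ∎
      where
      open ≤-Reasoning
      πb = PathTo-∷ʳ πₐ a∈ nb
      below-u = below-u-bound πᵤ (proj₁ (matched-below-u φb∈L')) (proj₂ (matched-below-u φb∈L')) π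
    ... | no φb∉L' =
      subst (λ t → length (qᵤ ++ t) ≤ d + size R) (++-assoc qₐ [ i ] q)
        (contractum-bound πᵤ (child∈ tgR a∈ nb) (PathTo-∷ʳ πₐ a∈ nb) φb∉L' π)

    contractum-root-bound : ∀ {qᵤ q w} → Pos S qᵤ u → PathTo G h q w →
      length (qᵤ ++ q) ≤ d + size R
    contractum-root-bound {qᵤ} {q} πᵤ π = by-cases (root R' ∈? nodes L')
      where
      -- A 'with' on this decision would also abstract it inside G, through h.
      by-cases : Dec (root R' ∈ nodes L') → length (qᵤ ++ q) ≤ d + size R
      by-cases (yes root∈L') =
        ≤-trans (below-u-bound πᵤ (proj₁ (matched-below-u root∈L')) (proj₂ (matched-below-u root∈L'))
                  (subst (λ t → PathTo G t _ _) (instantiate-∈ root∈L') π))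
                (m≤m+n _ _)
      by-cases (no root∉L') =
        contractum-bound πᵤ (IsTermGraph.root∈ tgR) here
          (subst (_∉ nodes L') (Renaming.root-eq R'-copy) root∉L')
          (subst (λ t → PathTo G t _ _) (trans (instantiate-∉ root∉L') (Renaming.root-eq R'-copy)) π)

    old-node-bound : ∀ {x q₀ q w} → x ∈ nodes S → Pos S q₀ x → PathTo G x q w →
      length (q₀ ++ q) ≤ d + size R
    old-node-bound {q₀ = q₀} x∈ π₀ here =
      subst (_≤ d + size R) (cong length (sym (++-identityʳ q₀))) (≤-trans (S-depth π₀) (m≤m+n _ _))
    old-node-bound {q₀ = q₀} {i ∷ q} x∈ π₀ (step _ n π)
      with Nth-map⁻ (subst (λ ws → Nth ws i _) (succ-old x∈) n)
    ... | z , nz , refl with z ≟ u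
    ... | yes refl =
      subst (λ t → length t ≤ d + size R) (++-assoc q₀ [ i ] q)
        (contractum-root-bound (PathTo-∷ʳ π₀ x∈ nz) (subst (λ t → PathTo G t _ _) redirect-≡ π))
    ... | no z≢u =
      subst (λ t → length t ≤ d + size R) (++-assoc q₀ [ i ] q)
        (old-node-bound (child∈ tgS x∈ nz) (PathTo-∷ʳ π₀ x∈ nz)
          (subst (λ t → PathTo G t _ _) (redirect-≢ z≢u) π))

    replaced-DepthBound : ∀ {T} → Replace S u m L' R' T → DepthBound T (d + size R)
    replaced-DepthBound T≤G πT with root S ≟ u | RestrictAt-PathTo T≤G πT
    ... | yes rootS≡u | π =
      contractum-root-bound (subst (Pos S []) rootS≡u here)
        (subst (λ t → PathTo G t _ _)
          (trans (RestrictAt.root-eq T≤G) (if-true (dec-true (root S ≟ u) rootS≡u))) π)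
    ... | no rootS≢u | π =
      old-node-bound (IsTermGraph.root∈ tgS) here
        (subst (λ t → PathTo G t _ _) (trans (RestrictAt.root-eq T≤G) (redirect-≢ rootS≢u)) π)

    replaced-size : ∀ {T} → IsTermGraph T → Replace S u m L' R' T → size T ≤ size S + size R
    replaced-size {T} tgT T≤G =
      subst (size T ≤_) (trans (length-++ (nodes S)) (cong (size S +_) (length-map φ (nodes R))))
        (Unique-⊆⇒length≤ (IsTermGraph.unique tgT) T⊆S+φR)
      where
      T⊆S+φR : ∀ {z} → z ∈ nodes T → z ∈ nodes S ++ map φ (nodes R)
      T⊆S+φR {z} z∈ with ∈-++⁻ (nodes S) (proj₁ (RestrictAt.nodes-iff₁ T≤G z z∈))
      ... | inj₁ z∈S = ∈-++⁺ˡ z∈S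
      ... | inj₂ z∈new with Renaming.nodes-iff₁ R'-copy z (proj₁ (∈-filter⁻ _ z∈new))
      ... | a , a∈ , refl = ∈-++⁺ʳ (nodes S) (∈-map⁺ φ a∈)

  rhsSizeSum : List GraphRule → ℕ
  rhsSizeSum gs = sum (map (λ g → size (proj₂ g)) gs)

  rhs-size≤rhsSizeSum : ∀ {L R gs} → (L , R) ∈ gs → size R ≤ rhsSizeSum gs
  rhs-size≤rhsSizeSum (here refl) = m≤m+n _ _
  rhs-size≤rhsSizeSum {gs = _ ∷ gs} (there g∈) = ≤-trans (rhs-size≤rhsSizeSum g∈) (m≤n+m _ _)

  simulating-rhs-IsTermGraph : ∀ {rs gs L R} → IsSimulatingGRS rs gs → (L , R) ∈ gs → IsTermGraph R
  simulating-rhs-IsTermGraph ((_ , (tgR , _) , _) ∷ _) (here refl) = tgR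
  simulating-rhs-IsTermGraph (_ ∷ sims) (there g∈) = simulating-rhs-IsTermGraph sims g∈

  RewriteStep-bounds : ∀ {rs gs p S T d} →
    IsSimulatingGRS rs gs → DepthBound S d → RewriteStep gs p S T →
    length p ≤ d × size T ≤ size S + rhsSizeSum gs × DepthBound T (d + rhsSizeSum gs)
  RewriteStep-bounds {d = d} sim S-depth
    (tgS , tgT , _ , πᵤ , _ , rule∈ , _ , _ , (_ , _ , _ , R'-copy) , fresh ,
     _ , H-below-u , _ , m-morphism , T≤G) =
    S-depth πᵤ ,
    ≤-trans (replaced-size tgT T≤G) (+-monoʳ-≤ _ R≤Σ) ,
    DepthBound-mono (+-monoʳ-≤ d R≤Σ) (replaced-DepthBound T≤G)
    where
    open Replacement tgS S-depth H-below-u m-morphism (simulating-rhs-IsTermGraph sim rule∈) R'-copy fresh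
    R≤Σ = rhs-size≤rhsSizeSum rule∈

  module _ (_≻_ : ℕ → ℕ → Set) (≻-irrefl : ∀ {x} → ¬ x ≻ x) where
    open Collapsing _≻_

    Down*-DepthBound : ∀ {p A B d} → Star (Down p) A B → DepthBound A d → DepthBound B d
    Down*-DepthBound ε bound = bound
    Down*-DepthBound ((_ , _ , _ , _ , tgA , _ , _ , _ , _ , A≥B) ◅ steps) bound =
      Down*-DepthBound steps (Geq-DepthBound tgA A≥B bound)

    Down*-size : ∀ {p A B} → Star (Down p) A B → size B ≤ size A
    Down*-size ε = ≤-refl
    Down*-size ((_ , _ , _ , _ , tgA , tgB , _ , _ , _ , A≥B) ◅ steps) =
      ≤-trans (Down*-size steps) (Geq-size tgA tgB A≥B)

    Up*-DepthBound : ∀ {p A B d} → Star (Up p) A B → DepthBound A d → DepthBound B d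
    Up*-DepthBound ε bound = bound
    Up*-DepthBound ((_ , _ , (tgB , _ , _ , _ , _ , B≥A) , _) ◅ steps) bound =
      Up*-DepthBound steps (Geq-DepthBound⁻ tgB B≥A bound)

    SharedAt : Graph → Position → Set
    SharedAt G q = ∃[ x ] ∃[ q' ] (Pos G q x × Pos G q' x × q' ≢ q)

    Up-SharedAt : ∀ {p A B q} → Up p A B → SharedAt B q → SharedAt A q
    Up-SharedAt (_ , _ , (tgB , _ , _ , _ , _ , B≥A) , _) (_ , q' , π , π' , q'≢q) =
      _ , q' , Geq-Pos tgB B≥A π , Geq-Pos tgB B≥A π' , q'≢q

    Up*-unshared-positions : ∀ {p A B} → Star (Up p) A B →
      ∃[ Qs ] (Unique Qs × All (_≤ₚ p) Qs × All (SharedAt A) Qs × size B ≤ size A + length Qs)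
    Up*-unshared-positions {A = A} ε = [] , [] , [] , [] , ≤-reflexive (sym (+-identityʳ (size A)))
    Up*-unshared-positions {A = A}
      (up@(u , v , (tgB , _ , _ , v∈ , u≻v , B≥A) , _ , q , πᵤ , q-unique , q≤p) ◅ steps)
      with Up*-unshared-positions steps
    ... | Qs , Qs! , Qs≤p , Qs-shared , size≤ =
      q ∷ Qs , q∉Qs ∷ Qs! , q≤p ∷ Qs≤p , q-shared ∷ All.map (Up-SharedAt up) Qs-shared ,
      ≤-trans size≤ (≤-trans (+-monoˡ-≤ (length Qs) (upd-size tgB B≥A))
                             (≤-reflexive (sym (+-suc (size A) (length Qs)))))
      where
      v≢u : v ≢ u
      v≢u v≡u = ≻-irrefl (subst (u ≻_) v≡u u≻v)
      -- v receives u's position q and keeps its own.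
      q-shared : SharedAt A q
      q-shared with Reach⇒PathTo (IsTermGraph.rooted tgB v v∈)
      ... | r , πᵥ =
        v , r , subst (Pos A q) (upd-≡ u v) (Geq-Pos tgB B≥A πᵤ) ,
                subst (Pos A r) (upd-≢ v≢u) (Geq-Pos tgB B≥A πᵥ) ,
        λ r≡q → v≢u (PathTo-functional πᵥ (subst (λ t → Pos _ t u) (sym r≡q) πᵤ))
      -- Positions in Qs are shared in B, whereas q is the only position of u in B.
      q∉Qs : All (q ≢_) Qs
      q∉Qs = All.map (λ { (_ , q' , πₓ , πₓ' , q'≢q) refl →
                          q'≢q (q-unique q' (subst (Pos _ q') (PathTo-functional πₓ πᵤ) πₓ')) })
                     Qs-shared

    Up*-size : ∀ {p A B} → Star (Up p) A B → size B ≤ size A + suc (length p)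
    Up*-size ups with Up*-unshared-positions ups
    ... | _ , Qs! , Qs≤p , _ , size≤ = ≤-trans size≤ (+-monoʳ-≤ _ (Unique-prefixes-length≤ Qs! Qs≤p))

    Step-bounds : ∀ {rs gs S T d} → IsSimulatingGRS rs gs → DepthBound S d → Step gs S T →
      size T ≤ size S + d + suc (rhsSizeSum gs) × DepthBound T (d + suc (rhsSizeSum gs))
    Step-bounds {gs = gs} {S} {T} {d} sim S-depth (p , S₁ , S₂ , (ups , _) , (downs , _) , rewrite-step)
      with RewriteStep-bounds sim (Down*-DepthBound downs (Up*-DepthBound ups S-depth)) rewrite-step
    ... | p≤d , T-size , T-depth = size-bound , DepthBound-mono (+-monoʳ-≤ d (n≤1+n _)) T-depth
      where
      open ≤-Reasoning
      K = rhsSizeSum gs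
      size-bound : size T ≤ size S + d + suc K
      size-bound = begin
        size T                      ≤⟨ T-size ⟩
        size S₂ + K                 ≤⟨ +-monoˡ-≤ K (Down*-size downs) ⟩
        size S₁ + K                 ≤⟨ +-monoˡ-≤ K (Up*-size ups) ⟩
        size S + suc (length p) + K ≤⟨ +-monoˡ-≤ K (+-monoʳ-≤ (size S) (s≤s p≤d)) ⟩
        size S + suc d + K          ≡⟨ cong (_+ K) (+-suc (size S) d) ⟩
        suc (size S + d + K)        ≡⟨ sym (+-suc (size S + d) K) ⟩
        size S + d + suc K          ∎

    Iter-size : ∀ {rs gs n S T d} → IsSimulatingGRS rs gs → DepthBound S d → Iter (Step gs) n S T →
      size T ≤ size S + n * d + n * n * suc (rhsSizeSum gs)
    Iter-size {S = S} sim _ zero = ≤-trans (m≤m+n (size S) 0) (m≤m+n (size S + 0) 0)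
    Iter-size {gs = gs} {suc n} {S} {T} {d} sim S-depth (step {b = S'} s steps)
      with Step-bounds sim S-depth s
    ... | S'-size , S'-depth = begin
      size T                                           ≤⟨ Iter-size sim S'-depth steps ⟩
      size S' + n * (d + Δ) + n * n * Δ                ≤⟨ +-monoˡ-≤ _ (+-monoˡ-≤ _ S'-size) ⟩
      size S + d + Δ + n * (d + Δ) + n * n * Δ         ≤⟨ m≤m+n _ (n * Δ) ⟩
      size S + d + Δ + n * (d + Δ) + n * n * Δ + n * Δ ≡⟨ iter-identity (size S) d Δ n ⟩
      size S + suc n * d + suc n * suc n * Δ           ∎
      where
      open ≤-Reasoning
      Δ = suc (rhsSizeSum gs)
      iter-identity : ∀ s d Δ n →
        s + d + Δ + n * (d + Δ) + n * n * Δ + n * Δ ≡ s + suc n * d + suc n * suc n * Δ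
      iter-identity = solve-∀

lemma26 : (Sig : Signature) → let open TRS Sig in
    (rs : List Rule) → IsTRS rs →
    (gs : List GraphRule) → IsSimulatingGRS rs gs →
    ∃[ Δ ] ((_≻_ : ℕ → ℕ → Set) → IsStrictTotalOrder _≡_ _≻_ →
    (S T : Graph) (ℓ : ℕ) → IsTermGraph S → IsTermGraph T →
    Iter (Collapsing.Step _≻_ gs) ℓ S T →
    size T ≤ suc ℓ * size S + ℓ * ℓ * Δ)
lemma26 _ _ _ gs sim = suc (rhsSizeSum gs) , λ _≻_ ≻-sto _ _ _ tgS _ steps →
  Iter-size _≻_ (IsStrictTotalOrder.irrefl ≻-sto refl) sim (size-DepthBound tgS) steps
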